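{- Let $B$ be a barrier, $I$ a set, and $g:B^2\to I$ a function such that for some function $\beta:B\to[I]^{<\omega}$ we have $g([a,b])\in\beta(a)$ for all $[a,b]\in B^2$. Then there are a sub-barrier $C\subseteq B$ and a function $i:C\to I$ such that $g([a,b])=i(a)$ for every $[a,b]\in C^2$.
   Context: A barrier is an infinite set $B\subseteq[\omega]^{<\omega}$ which is an antichain under $\subseteq$ and such that every infinite subset of its base $\bigcup B$ has an initial segment (the set of its $k$ smallest elements for some $k$) in $B$; a sub-barrier of $B$ is a barrier $C\subseteq B$. For $r,s\in[\omega]^{<\omega}$ with $r\ne\emptyset$, $r\triangleleft s$ means $\min r<\min s$ and $r\setminus\{\min r\}$ is a proper initial segment of $s$. $B^2=\{s\cup t: s,t\in B, s\triangleleft t\}$; each $u\in B^2$ determines uniquely $s,t\in B$ with $s\triangleleft t$ and $u=s\cup t$, written $u=[s,t]$. $[I]^{<\omega}$ denotes the set of finite subsets of $I$. -}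

module Defs where

open import Level using (Level; _⊔_) renaming (suc to lsuc)
open import Data.Nat using (ℕ; zero; suc; _<_; _≤_)
open import Data.Nat.Properties using (<-cmp)
open import Data.List using (List; []; _∷_; map; upTo; take; length)
open import Data.List.Membership.Propositional using (_∈_)
open import Data.List.Relation.Unary.Linked using (Linked)
open import Data.Product using (Σ; ∃; ∃-syntax; _×_; _,_)
open import Data.Empty using (⊥)
open import Relation.Binary.Definitions using (tri<; tri≈; tri>)
open import Relation.Binary.PropositionalEquality using (_≡_)
open import Relation.Nullary using (¬_; Dec)

-- A finite subset of ω is represented by the strictly increasing list of its elements.
StrictlyIncreasing : List ℕ → Set
StrictlyIncreasing = Linked _<_

Family : Set₁
Family = List ℕ → Set

_⊆ₗ_ : List ℕ → List ℕ → Set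
s ⊆ₗ t = ∀ x → x ∈ s → x ∈ t

_∪_ : List ℕ → List ℕ → List ℕ
[] ∪ ys = ys
(x ∷ xs) ∪ ys = ins xs ys
  where
  -- ins xs ys computes (x ∷ xs) ∪ ys
  ins : List ℕ → List ℕ → List ℕ
  ins xs [] = x ∷ xs
  ins xs (y ∷ ys) with <-cmp x y
  ... | tri< _ _ _ = x ∷ (xs ∪ (y ∷ ys))
  ... | tri≈ _ _ _ = x ∷ (xs ∪ ys)
  ... | tri> _ _ _ = y ∷ ins xs ys

Base : Family → ℕ → Set
Base B x = ∃[ s ] (B s × x ∈ s)

FiniteFamily : Family → Set
FiniteFamily B = ∃[ L ] (∀ s → B s → s ∈ L)

InfiniteFamily : Family → Set
InfiniteFamily B = ¬ FiniteFamily B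

-- An infinite subset of ω is given by its strictly increasing enumeration f;
-- its initial segment of size k (its k smallest elements) is f 0, …, f (k-1).
StrictlyIncreasingSeq : (ℕ → ℕ) → Set
StrictlyIncreasingSeq f = ∀ n → f n < f (suc n)

initSeg : (ℕ → ℕ) → ℕ → List ℕ
initSeg f k = map f (upTo k)

record IsBarrier (B : Family) : Set where
  field
    finiteSets : ∀ s → B s → StrictlyIncreasing s
    infinite   : InfiniteFamily B
    antichain  : ∀ s t → B s → B t → s ⊆ₗ t → s ≡ t
    initial    : ∀ (f : ℕ → ℕ) → StrictlyIncreasingSeq f → (∀ n → Base B (f n))
                 → ∃[ k ] B (initSeg f k)

-- r ◁ s : r ≠ ∅, min r < min s, and r ∖ {min r} is a proper initial segment of s.
-- (For strictly increasing lists, the min is the head and initial segments are prefixes.)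
_◁_ : List ℕ → List ℕ → Set
r ◁ s = ∃[ x ] ∃[ r′ ] ∃[ y ] ∃[ s′ ]
          (r ≡ x ∷ r′ × s ≡ y ∷ s′ × x < y
           × ∃[ k ] (k < length s × r′ ≡ take k s))

-- Excluded middle (the statement is a theorem of classical mathematics).
ExcludedMiddle : Set₁
ExcludedMiddle = (P : Set) → Dec P

-- Fix a ∈ B and a colour y, and consider the family of sets t such that b = (a ∖ {min a}) ∪ t is in B with
-- a ◁ b and g([a,b]) = y. By the Nash-Williams dichotomy every infinite M contains an infinite N such that
-- either no finite subset of N is in this family, or every infinite subset of N has an initial segment in it.
-- Applying this to the finitely many colours in β(a), every b whose new part lies in N gets a colour of the
-- second kind, and the antichain property of B forces all such b to have that same colour. A fusion
-- (diagonal) argument makes these choices for all a ⊆ N simultaneously; B restricted to N is the required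
-- sub-barrier, and i(a) is the common colour. Both the dichotomy and the fusion are proved classically
-- in the style of Galvin and Prikry, by deciding for each s whether some infinite set accepts it.

module Submission where

open import Defs
open import Data.Empty using (⊥; ⊥-elim)
open import Data.List using (List; []; _∷_; _++_; _∷ʳ_; take; drop; map)
open import Data.List.Properties using (++-assoc; ++-identityʳ; take++drop≡id)
open import Data.List.Membership.Propositional using (_∈_)
open import Data.List.Membership.Propositional.Properties using (∈-++⁺ˡ; ∈-++⁺ʳ; ∈-map⁺)
open import Data.List.Relation.Binary.Sublist.Propositional as Sublist using (_⊆_; []; _∷_; minimum)
open import Data.List.Relation.Unary.Any using (here; there)
open import Data.List.Relation.Unary.All as All using (All; []; _∷_)
open import Data.List.Relation.Unary.All.Properties using (++⁺; ++⁻ʳ; drop⁺; map⁺; applyUpTo⁺₂)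
open import Data.List.Relation.Unary.Linked as Linked using (Linked; []; [-]; _∷_)
open import Data.List.Relation.Unary.Linked.Properties using (Linked⇒All)
open import Data.Nat using (ℕ; zero; suc; _+_; _<_; _≤_; z≤n; s≤s)
open import Data.Nat.ListAction using (sum)
open import Data.Nat.Properties
open import Data.Product using (Σ; ∃-syntax; _×_; _,_; proj₁; proj₂)
open import Data.Sum using (_⊎_; inj₁; inj₂)
open import Function using (_∘_; id)
open import Relation.Nullary using (¬_; yes; no)
open import Relation.Binary.PropositionalEquality

record InfSet : Set where
  constructor mkInfSet
  field
    enum       : ℕ → ℕ
    increasing : StrictlyIncreasingSeq enum
open InfSet public

_∈ᵢ_ : ℕ → InfSet → Set
z ∈ᵢ X = ∃[ k ] enum X k ≡ z

record _⊆ᵢ_ (X Y : InfSet) : Set where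
  constructor mk⊆ᵢ
  field enum-∈ᵢ : ∀ k → enum X k ∈ᵢ Y
open _⊆ᵢ_ public

⊆ᵢ-refl : ∀ {X} → X ⊆ᵢ X
⊆ᵢ-refl = mk⊆ᵢ λ k → k , refl

∈ᵢ-⊆ᵢ : ∀ {z X Y} → z ∈ᵢ X → X ⊆ᵢ Y → z ∈ᵢ Y
∈ᵢ-⊆ᵢ (k , refl) X⊆Y = enum-∈ᵢ X⊆Y k

⊆ᵢ-trans : ∀ {X Y Z} → X ⊆ᵢ Y → Y ⊆ᵢ Z → X ⊆ᵢ Z
⊆ᵢ-trans X⊆Y Y⊆Z = mk⊆ᵢ λ k → ∈ᵢ-⊆ᵢ (enum-∈ᵢ X⊆Y k) Y⊆Z

All-∈ᵢ-⊆ᵢ : ∀ {s X Y} → All (_∈ᵢ X) s → X ⊆ᵢ Y → All (_∈ᵢ Y) s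
All-∈ᵢ-⊆ᵢ s⊆X X⊆Y = All.map (λ z∈X → ∈ᵢ-⊆ᵢ z∈X X⊆Y) s⊆X

module _ {f : ℕ → ℕ} (f-inc : StrictlyIncreasingSeq f) where

  increasing-< : ∀ {i j} → i < j → f i < f j
  increasing-< {i} {suc j} i<1+j with m<1+n⇒m<n∨m≡n i<1+j
  ... | inj₁ i<j  = <-trans (increasing-< i<j) (f-inc j)
  ... | inj₂ refl = f-inc i

  increasing-≤ : ∀ {i j} → i ≤ j → f i ≤ f j
  increasing-≤ i≤j with m≤n⇒m<n∨m≡n i≤j
  ... | inj₁ i<j  = <⇒≤ (increasing-< i<j)
  ... | inj₂ refl = ≤-refl

  increasing-cancel-< : ∀ {i j} → f i < f j → i < j
  increasing-cancel-< fi<fj = ≰⇒> (λ j≤i → <⇒≱ fi<fj (increasing-≤ j≤i))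

  increasing-inflationary : ∀ k → k ≤ f k
  increasing-inflationary zero    = z≤n
  increasing-inflationary (suc k) = ≤-trans (s≤s (increasing-inflationary k)) (f-inc k)

dropᵢ : ℕ → InfSet → InfSet
dropᵢ d X = mkInfSet (λ k → enum X (k + d)) (λ k → increasing X (k + d))

dropᵢ-⊆ᵢ : ∀ d X → dropᵢ d X ⊆ᵢ X
dropᵢ-⊆ᵢ d X = mk⊆ᵢ λ k → k + d , refl

tailᵢ : InfSet → InfSet
tailᵢ X = mkInfSet (enum X ∘ suc) (increasing X ∘ suc)

tailᵢ-⊆ᵢ : ∀ X → tailᵢ X ⊆ᵢ X
tailᵢ-⊆ᵢ X = mk⊆ᵢ λ k → suc k , refl

segment : (ℕ → ℕ) → ℕ → List ℕ
segment f zero    = []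
segment f (suc k) = f 0 ∷ segment (f ∘ suc) k

All-initSeg : ∀ {P : ℕ → Set} f → (∀ j → P (f j)) → ∀ k → All P (initSeg f k)
All-initSeg f Pf k = map⁺ (applyUpTo⁺₂ id k Pf)

segment-suc : ∀ f k → segment f (suc k) ≡ segment f k ∷ʳ f k
segment-suc f zero    = refl
segment-suc f (suc k) = cong (f 0 ∷_) (segment-suc (f ∘ suc) k)

∈⇒≤sum : ∀ {z s} → z ∈ s → z ≤ sum s
∈⇒≤sum {s = x ∷ s} (here refl) = m≤m+n x (sum s)
∈⇒≤sum {s = x ∷ s} (there z∈s) = ≤-trans (∈⇒≤sum z∈s) (m≤n+m (sum s) x)

bound : List ℕ → ℕ
bound s = suc (sum s)

<-bound : ∀ s → All (_< bound s) s
<-bound s = All.tabulate (s≤s ∘ ∈⇒≤sum)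

Above : List ℕ → InfSet → Set
Above s X = ∀ k → All (_< enum X k) s

Above-dropᵢ-bound : ∀ s X → Above s (dropᵢ (bound s) X)
Above-dropᵢ-bound s X k = All.map (λ z<b → <-≤-trans z<b (bound≤ k)) (<-bound s)
  where
  bound≤ : ∀ k → bound s ≤ enum X (k + bound s)
  bound≤ k = ≤-trans (m≤n+m (bound s) k) (increasing-inflationary (increasing X) (k + bound s))

Linked-head< : ∀ {z s} → StrictlyIncreasing (z ∷ s) → All (z <_) s
Linked-head< [-]       = []
Linked-head< (z<y ∷ l) = Linked⇒All <-trans z<y l

Linked-∷ʳ : ∀ {z} p → StrictlyIncreasing p → All (_< z) p → StrictlyIncreasing (p ∷ʳ z)
Linked-∷ʳ []          _         _             = [-]
Linked-∷ʳ (x ∷ [])    _         (x<z ∷ [])    = x<z ∷ [-]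
Linked-∷ʳ (x ∷ y ∷ p) (x<y ∷ l) (_ ∷ p<z)     = x<y ∷ Linked-∷ʳ (y ∷ p) l p<z

Linked-drop : ∀ k {s} → StrictlyIncreasing s → StrictlyIncreasing (drop k s)
Linked-drop zero    l          = l
Linked-drop (suc k) {[]}    l  = []
Linked-drop (suc k) {x ∷ s} l  = Linked-drop k (Linked.tail l)

Linked-++⇒< : ∀ p q → StrictlyIncreasing (p ++ q) → All (λ z → All (_< z) p) q
Linked-++⇒< []      q l = All.universal (λ _ → []) q
Linked-++⇒< (x ∷ p) q l =
  All.zipWith (λ (x<z , p<z) → x<z ∷ p<z) (++⁻ʳ p (Linked-head< l) , Linked-++⇒< p q (Linked.tail l))

InSegment : (ℕ → ℕ) → ℕ → List ℕ → Set
InSegment f k = All (λ w → ∃[ j ] (j < k × f j ≡ w))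

InSegment-tail : ∀ {f k} s → InSegment f (suc k) s → All (f 0 <_) s → InSegment (f ∘ suc) k s
InSegment-tail []      []                           []            = []
InSegment-tail (w ∷ s) ((zero  , _       , refl) ∷ ix) (f0<f0 ∷ _) = ⊥-elim (<-irrefl refl f0<f0)
InSegment-tail (w ∷ s) ((suc j , s≤s j<k , fj≡w) ∷ ix) (_ ∷ f0<s)  = (j , j<k , fj≡w) ∷ InSegment-tail s ix f0<s

InSegment⇒⊆segment : ∀ k {f} → StrictlyIncreasingSeq f → ∀ {s} → StrictlyIncreasing s →
                      InSegment f k s → s ⊆ segment f k
InSegment⇒⊆segment zero    _ {[]}    _ _                   = []
InSegment⇒⊆segment zero    _ {_ ∷ _} _ ((_ , () , _) ∷ _)
InSegment⇒⊆segment (suc k) _ {[]}    _ _                   = minimum _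
InSegment⇒⊆segment (suc k) {f} f-inc {_ ∷ s} l ((zero , _ , refl) ∷ ix) =
  refl ∷ InSegment⇒⊆segment k (f-inc ∘ suc) (Linked.tail l) (InSegment-tail s ix (Linked-head< l))
InSegment⇒⊆segment (suc k) {f} f-inc {_ ∷ s} l ix@((suc j , _ , refl) ∷ _) =
  f 0 Sublist.∷ʳ InSegment⇒⊆segment k (f-inc ∘ suc) l (InSegment-tail (f (suc j) ∷ s) ix f0<)
  where
  f0<fj : f 0 < f (suc j)
  f0<fj = increasing-< f-inc (s≤s z≤n)
  f0< : All (f 0 <_) (f (suc j) ∷ s)
  f0< = f0<fj ∷ All.map (<-trans f0<fj) (Linked-head< l)

sublists : ∀ {A : Set} → List A → List (List A)
sublists []      = [] ∷ []
sublists (x ∷ L) = sublists L ++ map (x ∷_) (sublists L)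

∈-sublists : ∀ {A : Set} {s L : List A} → s ⊆ L → s ∈ sublists L
∈-sublists []                     = here refl
∈-sublists {L = x ∷ L} (_ Sublist.∷ʳ s⊆L) = ∈-++⁺ˡ (∈-sublists s⊆L)
∈-sublists {L = x ∷ L} (refl ∷ s⊆L) = ∈-++⁺ʳ (sublists L) (∈-map⁺ (x ∷_) (∈-sublists s⊆L))

bounded⇒finite : ∀ {F : Family} m → (∀ s → F s → StrictlyIncreasing s) → (∀ z → Base F z → z ≤ m) →
                 FiniteFamily F
bounded⇒finite m F-inc F≤m = sublists (segment id (suc m)) , λ s Fs →
  ∈-sublists (InSegment⇒⊆segment (suc m) n<1+n (F-inc s Fs)
               (All.tabulate λ {z} z∈s → z , s≤s (F≤m z (s , Fs , z∈s)) , refl))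

module _ (em : ExcludedMiddle) {F : Family}
         (F-inc : ∀ s → F s → StrictlyIncreasing s) (F-inf : InfiniteFamily F) where

  Base-unbounded : ∀ m → ∃[ z ] (m < z × Base F z)
  Base-unbounded m with em (∃[ z ] (m < z × Base F z))
  ... | yes above-m = above-m
  ... | no ¬above-m = ⊥-elim (F-inf (bounded⇒finite m F-inc λ z Fz → ≮⇒≥ λ m<z → ¬above-m (z , m<z , Fz)))

  private
    baseEnum : ℕ → ℕ
    baseEnum zero    = proj₁ (Base-unbounded 0)
    baseEnum (suc k) = proj₁ (Base-unbounded (baseEnum k))

  baseInfSet : InfSet
  baseInfSet = mkInfSet baseEnum (λ k → proj₁ (proj₂ (Base-unbounded (baseEnum k))))

  baseInfSet-⊆Base : ∀ {z} → z ∈ᵢ baseInfSet → Base F z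
  baseInfSet-⊆Base (zero  , refl) = proj₂ (proj₂ (Base-unbounded 0))
  baseInfSet-⊆Base (suc k , refl) = proj₂ (proj₂ (Base-unbounded (baseEnum k)))

Pred₂ : Set₁
Pred₂ = List ℕ → InfSet → Set

_⊆ᵢ_above_ : InfSet → InfSet → List ℕ → Set
X ⊆ᵢ Y above s = ∀ k → All (_< enum X k) s → enum X k ∈ᵢ Y

⊆ᵢ⇒⊆ᵢ-above : ∀ {X Y} s → X ⊆ᵢ Y → X ⊆ᵢ Y above s
⊆ᵢ⇒⊆ᵢ-above s X⊆Y k _ = enum-∈ᵢ X⊆Y k

Hereditary : Pred₂ → Set
Hereditary P = ∀ s X Y → X ⊆ᵢ Y → P s Y → P s X

HereditaryAbove : Pred₂ → Set
HereditaryAbove P = ∀ s X Y → X ⊆ᵢ Y above s → P s Y → P s X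

HereditaryAbove⇒Hereditary : ∀ {P} → HereditaryAbove P → Hereditary P
HereditaryAbove⇒Hereditary her s X Y = her s X Y ∘ ⊆ᵢ⇒⊆ᵢ-above s

Dense : Pred₂ → Set
Dense P = ∀ s M → ∃[ N ] (N ⊆ᵢ M × P s N)

Everywhere : Pred₂ → InfSet → Set
Everywhere P N = ∀ s → StrictlyIncreasing s → All (_∈ᵢ N) s → P s N

Dense-sublists : ∀ {P} → Hereditary P → Dense P → ∀ L M → ∃[ N ] (N ⊆ᵢ M × (∀ s → s ⊆ L → P s N))
Dense-sublists {P} her dense [] M with dense [] M
... | N , N⊆M , P[]N = N , N⊆M , λ { .[] [] → P[]N }
Dense-sublists {P} her dense (x ∷ L) M with Dense-sublists her dense L M
... | N₁ , N₁⊆M , P-L with Dense-sublists {λ s → P (x ∷ s)} (λ s → her (x ∷ s)) (λ s → dense (x ∷ s)) L N₁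
... | N₂ , N₂⊆N₁ , P-x∷L = N₂ , ⊆ᵢ-trans N₂⊆N₁ N₁⊆M , P-sub
  where
  P-sub : ∀ s → s ⊆ x ∷ L → P s N₂
  P-sub s (_ Sublist.∷ʳ s⊆L) = her s N₂ N₁ N₂⊆N₁ (P-L s s⊆L)
  P-sub (_ ∷ s) (refl ∷ s⊆L) = P-x∷L s s⊆L

lastIndex : ∀ {f} → StrictlyIncreasingSeq f → ∀ z s → StrictlyIncreasing (z ∷ s) →
            All (λ w → ∃[ j ] f j ≡ w) (z ∷ s) →
            ∃[ K ] (InSegment f (suc K) (z ∷ s) × (∀ k → All (_< f k) (z ∷ s) → K < k))
lastIndex f-inc z [] _ ((j , refl) ∷ []) =
  j , (j , ≤-refl , refl) ∷ [] , λ { k (fj<fk ∷ []) → increasing-cancel-< f-inc fj<fk }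
lastIndex f-inc z (y ∷ s) (z<y ∷ l) ((j , refl) ∷ ix) with lastIndex f-inc y s l ix
... | K , ix′@((jy , jy<1+K , refl) ∷ _) , K<above =
  K , (j , <-trans (increasing-cancel-< f-inc z<y) jy<1+K , refl) ∷ ix′ , λ { k (_ ∷ s<fk) → K<above k s<fk }

module Fusion {P : Pred₂} (her : HereditaryAbove P) (dense : Dense P) (M : InfSet) where

  her′ : Hereditary P
  her′ = HereditaryAbove⇒Hereditary her

  record Stage : Set where
    constructor stage
    field
      chosen    : List ℕ
      reservoir : InfSet
      decided   : ∀ s → s ⊆ chosen → P s reservoir
  open Stage

  refine : ∀ L X → ∃[ N ] (N ⊆ᵢ X × (∀ s → s ⊆ L → P s N))
  refine = Dense-sublists her′ dense

  next : Stage → Stage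
  next S = stage L′ (proj₁ R) (proj₂ (proj₂ R))
    where
    L′ = chosen S ∷ʳ enum (reservoir S) 0
    R = refine L′ (tailᵢ (reservoir S))

  next-⊆ᵢ : ∀ S → reservoir (next S) ⊆ᵢ tailᵢ (reservoir S)
  next-⊆ᵢ S = proj₁ (proj₂ (refine (chosen S ∷ʳ enum (reservoir S) 0) (tailᵢ (reservoir S))))

  stageAt : ℕ → Stage
  stageAt zero    = stage [] (proj₁ (refine [] M)) (proj₂ (proj₂ (refine [] M)))
  stageAt (suc k) = next (stageAt k)

  Mₖ : ℕ → InfSet
  Mₖ k = reservoir (stageAt k)

  M₀-⊆ᵢ : Mₖ 0 ⊆ᵢ M
  M₀-⊆ᵢ = proj₁ (proj₂ (refine [] M))

  Mₖ-step : ∀ k → Mₖ (suc k) ⊆ᵢ Mₖ k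
  Mₖ-step k = ⊆ᵢ-trans (next-⊆ᵢ (stageAt k)) (tailᵢ-⊆ᵢ (Mₖ k))

  Mₖ-antitone : ∀ {k j} → k ≤ j → Mₖ j ⊆ᵢ Mₖ k
  Mₖ-antitone {k} {j} k≤j with m≤n⇒m<n∨m≡n k≤j
  ... | inj₂ refl = ⊆ᵢ-refl
  Mₖ-antitone {k} {suc j} _ | inj₁ k<1+j = ⊆ᵢ-trans (Mₖ-step j) (Mₖ-antitone (≤-pred k<1+j))

  fused : ℕ → ℕ
  fused k = enum (Mₖ k) 0

  fused-increasing : StrictlyIncreasingSeq fused
  fused-increasing k with enum-∈ᵢ (next-⊆ᵢ (stageAt k)) 0
  ... | j , e = subst (fused k <_) e (increasing-< (increasing (Mₖ k)) (s≤s z≤n))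

  N : InfSet
  N = mkInfSet fused fused-increasing

  fused-∈ᵢ : ∀ {k} j → k ≤ j → fused j ∈ᵢ Mₖ k
  fused-∈ᵢ j k≤j = ∈ᵢ-⊆ᵢ (0 , refl) (Mₖ-antitone k≤j)

  N-⊆ᵢ : N ⊆ᵢ M
  N-⊆ᵢ = mk⊆ᵢ λ k → ∈ᵢ-⊆ᵢ (fused-∈ᵢ k z≤n) M₀-⊆ᵢ

  chosen≡segment : ∀ k → chosen (stageAt k) ≡ segment fused k
  chosen≡segment zero    = refl
  chosen≡segment (suc k) = trans (cong (_∷ʳ fused k) (chosen≡segment k)) (sym (segment-suc fused k))

  -- s is decided at the stage right after its last element was chosen; all later elements of N lie in that reservoir.
  everywhere : Everywhere P N
  everywhere [] _ _ = her′ [] N (Mₖ 0) (mk⊆ᵢ λ k → fused-∈ᵢ k z≤n) (decided (stageAt 0) [] [])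
  everywhere (z ∷ s) l s⊆N with lastIndex fused-increasing z s l s⊆N
  ... | K , ix , K<above = her (z ∷ s) N (Mₖ (suc K)) (λ k s<fk → fused-∈ᵢ k (K<above k s<fk))
                              (decided (stageAt (suc K)) (z ∷ s) s⊆chosen)
    where
    s⊆chosen : z ∷ s ⊆ chosen (stageAt (suc K))
    s⊆chosen = subst (z ∷ s ⊆_) (sym (chosen≡segment (suc K))) (InSegment⇒⊆segment (suc K) fused-increasing l ix)

fusion : ∀ {P} → HereditaryAbove P → Dense P → ∀ M → ∃[ N ] (N ⊆ᵢ M × Everywhere P N)
fusion her dense M = N , N-⊆ᵢ , everywhere
  where open Fusion her dense M

module Thinning (M : InfSet) (Q : ℕ → Set) (meets : ∀ X → X ⊆ᵢ M → ∃[ j ] Q (enum X j)) where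

  witnessFrom : ℕ → ℕ
  witnessFrom d = proj₁ (meets (dropᵢ d M) (dropᵢ-⊆ᵢ d M)) + d

  Q-witnessFrom : ∀ d → Q (enum M (witnessFrom d))
  Q-witnessFrom d = proj₂ (meets (dropᵢ d M) (dropᵢ-⊆ᵢ d M))

  position : ℕ → ℕ
  position zero    = witnessFrom 0
  position (suc i) = witnessFrom (suc (position i))

  Q-position : ∀ i → Q (enum M (position i))
  Q-position zero    = Q-witnessFrom 0
  Q-position (suc i) = Q-witnessFrom (suc (position i))

  X : InfSet
  X = mkInfSet (enum M ∘ position) (λ i → increasing-< (increasing M) (m≤n+m (suc (position i)) _))

thinning : ∀ M (Q : ℕ → Set) → (∀ X → X ⊆ᵢ M → ∃[ j ] Q (enum X j)) →
           ∃[ X ] (X ⊆ᵢ M × (∀ i → Q (enum X i)))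
thinning M Q meets = X , mk⊆ᵢ (λ i → position i , refl) , Q-position
  where open Thinning M Q meets

module NashWilliams (em : ExcludedMiddle) (F : List ℕ → Set) where

  Accepts : InfSet → List ℕ → Set
  Accepts Y s = ∀ X → X ⊆ᵢ Y → Above s X → ∃[ k ] F (s ++ segment (enum X) k)

  Rejects : InfSet → List ℕ → Set
  Rejects Y s = ∀ Z → Z ⊆ᵢ Y → Above s Z → ¬ Accepts Z s

  Avoids : InfSet → Set
  Avoids N = ∀ s → StrictlyIncreasing s → All (_∈ᵢ N) s → ¬ F s

  ⊆ᵢ-above-trans : ∀ {s X Y Z} → X ⊆ᵢ Y above s → Z ⊆ᵢ X → Above s Z → Z ⊆ᵢ Y
  ⊆ᵢ-above-trans {s} {X} {Y} {Z} X⊆Y Z⊆X s<Z = mk⊆ᵢ λ k → ∈Y k (enum-∈ᵢ Z⊆X k)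
    where
    ∈Y : ∀ k → enum Z k ∈ᵢ X → enum Z k ∈ᵢ Y
    ∈Y k (j , zₖ≡xⱼ) = subst (_∈ᵢ Y) zₖ≡xⱼ (X⊆Y j (subst (λ v → All (_< v) s) (sym zₖ≡xⱼ) (s<Z k)))

  Decides : Pred₂
  Decides s X = Accepts X s ⊎ Rejects X s

  Decides-hereditary : HereditaryAbove Decides
  Decides-hereditary s X Y X⊆Y (inj₁ acc) = inj₁ λ W W⊆X s<W → acc W (⊆ᵢ-above-trans X⊆Y W⊆X s<W) s<W
  Decides-hereditary s X Y X⊆Y (inj₂ rej) = inj₂ λ Z Z⊆X s<Z → rej Z (⊆ᵢ-above-trans X⊆Y Z⊆X s<Z) s<Z

  Decides-dense : Dense Decides
  Decides-dense s M with em (∃[ Z ] (Z ⊆ᵢ M × Above s Z × Accepts Z s))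
  ... | yes (Z , Z⊆M , _ , acc) = Z , Z⊆M , inj₁ acc
  ... | no ¬acc = M , ⊆ᵢ-refl , inj₂ λ Z Z⊆M s<Z acc → ¬acc (Z , Z⊆M , s<Z , acc)

  module Avoiding (N₁ : InfSet) (decides : Everywhere Decides N₁) (rejects[] : Rejects N₁ []) where

    RejectsExtensions : List ℕ → InfSet → Set
    RejectsExtensions s X = ∀ j → All (_< enum X j) s → enum X j ∈ᵢ N₁ → Rejects N₁ (s ∷ʳ enum X j)

    Persistent : Pred₂
    Persistent s X = StrictlyIncreasing s → All (_∈ᵢ N₁) s → Rejects N₁ s → RejectsExtensions s X

    Persistent-hereditary : HereditaryAbove Persistent
    Persistent-hereditary s X Y X⊆Y persists l s⊆N₁ rej j s<x x∈N₁ with X⊆Y j s<x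
    ... | i , yᵢ≡xⱼ = subst (λ v → Rejects N₁ (s ∷ʳ v)) yᵢ≡xⱼ
                        (persists l s⊆N₁ rej i (subst (λ v → All (_< v) s) (sym yᵢ≡xⱼ) s<x)
                                                (subst (_∈ᵢ N₁) (sym yᵢ≡xⱼ) x∈N₁))

    Accepts-∷ʳ⇒Accepts : ∀ s X → X ⊆ᵢ N₁ → (∀ i → Accepts N₁ (s ∷ʳ enum X i)) → Accepts X s
    Accepts-∷ʳ⇒Accepts s X X⊆N₁ acc W W⊆X s<W with enum-∈ᵢ W⊆X 0
    ... | i , xᵢ≡w₀ with acc i (tailᵢ W) (⊆ᵢ-trans (tailᵢ-⊆ᵢ W) (⊆ᵢ-trans W⊆X X⊆N₁)) s∷ʳw₀<W
      where
      s∷ʳw₀<W : Above (s ∷ʳ enum X i) (tailᵢ W)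
      s∷ʳw₀<W k = ++⁺ (s<W (suc k)) (subst (_< enum W (suc k)) (sym xᵢ≡w₀) (increasing-< (increasing W) (s≤s z≤n)) ∷ [])
    ... | k , F-ext = suc k , subst F s∷ʳw₀++≡ F-ext
      where
      s∷ʳw₀++≡ : (s ∷ʳ enum X i) ++ segment (enum W ∘ suc) k ≡ s ++ segment (enum W) (suc k)
      s∷ʳw₀++≡ = trans (++-assoc s _ _) (cong (λ w → s ++ w ∷ segment (enum W ∘ suc) k) xᵢ≡w₀)

    -- If no X ⊆ M rejects all one-point extensions of s, every subset of M has an element z with s ∷ʳ z accepted;
    -- thinning M to such z gives a subset of N₁ accepting s, although N₁ rejects s.
    Persistent-dense : Dense Persistent
    Persistent-dense s M with em (StrictlyIncreasing s × All (_∈ᵢ N₁) s × Rejects N₁ s)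
    ... | no ¬hyp = M , ⊆ᵢ-refl , λ l s⊆N₁ rej → ⊥-elim (¬hyp (l , s⊆N₁ , rej))
    ... | yes (l , s⊆N₁ , rej) with em (∃[ X ] (X ⊆ᵢ M × RejectsExtensions s X))
    ...   | yes (X , X⊆M , rejExt) = X , X⊆M , λ _ _ _ → rejExt
    ...   | no ¬rejExt =
      ⊥-elim (rej X X⊆N₁ (λ i → proj₁ (Q-X i)) (Accepts-∷ʳ⇒Accepts s X X⊆N₁ (proj₂ ∘ proj₂ ∘ Q-X)))
      where
      Q : ℕ → Set
      Q z = All (_< z) s × z ∈ᵢ N₁ × Accepts N₁ (s ∷ʳ z)

      meets : ∀ Y → Y ⊆ᵢ M → ∃[ j ] Q (enum Y j)
      meets Y Y⊆M with em (∃[ j ] Q (enum Y j))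
      ... | yes q = q
      ... | no ¬q = ⊥-elim (¬rejExt (Y , Y⊆M , rejExt))
        where
        rejExt : RejectsExtensions s Y
        rejExt j s<y y∈N₁ with decides (s ∷ʳ enum Y j) (Linked-∷ʳ s l s<y) (++⁺ s⊆N₁ (y∈N₁ ∷ []))
        ... | inj₁ acc = ⊥-elim (¬q (j , s<y , y∈N₁ , acc))
        ... | inj₂ rej′ = rej′

      X = proj₁ (thinning M Q meets)
      Q-X = proj₂ (proj₂ (thinning M Q meets))

      X⊆N₁ : X ⊆ᵢ N₁
      X⊆N₁ = mk⊆ᵢ λ i → proj₁ (proj₂ (Q-X i))

    private
      fused = fusion Persistent-hereditary Persistent-dense N₁

    N₂ : InfSet
    N₂ = proj₁ fused

    N₂⊆N₁ : N₂ ⊆ᵢ N₁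
    N₂⊆N₁ = proj₁ (proj₂ fused)

    N₂-persistent : Everywhere Persistent N₂
    N₂-persistent = proj₂ (proj₂ fused)

    Rejects-++ : ∀ p s → StrictlyIncreasing p → All (_∈ᵢ N₂) p → Rejects N₁ p →
                 StrictlyIncreasing s → All (_∈ᵢ N₂) s → All (λ w → All (w <_) s) p → Rejects N₁ (p ++ s)
    Rejects-++ p []      _  _    rej _ _ _ = subst (Rejects N₁) (sym (++-identityʳ p)) rej
    Rejects-++ p (z ∷ s) lp p⊆N₂ rej l ((j , refl) ∷ s⊆N₂) p<z∷s =
      subst (Rejects N₁) (++-assoc p (z ∷ []) s)
        (Rejects-++ (p ∷ʳ z) s (Linked-∷ʳ p lp p<z) (++⁺ p⊆N₂ ((j , refl) ∷ [])) rej∷ʳz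
                    (Linked.tail l) s⊆N₂ p∷ʳz<s)
      where
      p<z : All (_< z) p
      p<z = All.map All.head p<z∷s
      p∷ʳz<s : All (λ w → All (w <_) s) (p ∷ʳ z)
      p∷ʳz<s = ++⁺ (All.map All.tail p<z∷s) (Linked-head< l ∷ [])
      rej∷ʳz : Rejects N₁ (p ∷ʳ z)
      rej∷ʳz = N₂-persistent p lp p⊆N₂ lp (All-∈ᵢ-⊆ᵢ p⊆N₂ N₂⊆N₁) rej j p<z (enum-∈ᵢ N₂⊆N₁ j)

    -- A member s of F would be accepted by every infinite set above s.
    N₂-avoids : Avoids N₂
    N₂-avoids s l s⊆N₂ Fs =
      Rejects-++ [] s [] [] rejects[] l s⊆N₂ [] (dropᵢ (bound s) N₁) (dropᵢ-⊆ᵢ _ N₁) (Above-dropᵢ-bound s N₁)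
        λ _ _ _ → 0 , subst F (sym (++-identityʳ s)) Fs

  nashWilliams : ∀ M → ∃[ N ] (N ⊆ᵢ M × (Avoids N ⊎ Accepts N []))
  nashWilliams M with fusion Decides-hereditary Decides-dense M
  ... | N₁ , N₁⊆M , decides with decides [] [] []
  ... | inj₁ acc = N₁ , N₁⊆M , inj₂ acc
  ... | inj₂ rej = N₂ , ⊆ᵢ-trans N₂⊆N₁ N₁⊆M , inj₁ N₂-avoids
    where open Avoiding N₁ decides rej

_++ˢ_ : List ℕ → (ℕ → ℕ) → ℕ → ℕ
([] ++ˢ f) k            = f k
((x ∷ t) ++ˢ f) zero    = x
((x ∷ t) ++ˢ f) (suc k) = (t ++ˢ f) k

++ˢ-increasing : ∀ t f → StrictlyIncreasing t → All (_< f 0) t → StrictlyIncreasingSeq f → StrictlyIncreasingSeq (t ++ˢ f)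
++ˢ-increasing []          f _         _            f-inc k       = f-inc k
++ˢ-increasing (x ∷ [])    f _         (x<f₀ ∷ [])  f-inc zero    = x<f₀
++ˢ-increasing (x ∷ [])    f _         _            f-inc (suc k) = f-inc k
++ˢ-increasing (x ∷ y ∷ t) f (x<y ∷ l) _            f-inc zero    = x<y
++ˢ-increasing (x ∷ y ∷ t) f (x<y ∷ l) (_ ∷ t<f₀)   f-inc (suc k) = ++ˢ-increasing (y ∷ t) f l t<f₀ f-inc k

++ˢ-∈ᵢ : ∀ {N} t f → All (_∈ᵢ N) t → (∀ k → f k ∈ᵢ N) → ∀ k → (t ++ˢ f) k ∈ᵢ N
++ˢ-∈ᵢ []      f _            f∈N k       = f∈N k
++ˢ-∈ᵢ (x ∷ t) f (x∈N ∷ _)    f∈N zero    = x∈N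
++ˢ-∈ᵢ {N} (x ∷ t) f (_ ∷ t⊆N) f∈N (suc k) = ++ˢ-∈ᵢ {N} t f t⊆N f∈N k

PrefixComparable : List ℕ → List ℕ → Set
PrefixComparable u t = (∃[ m ] u ++ m ≡ t) ⊎ (∃[ m ] t ++ m ≡ u)

segment-++ˢ-comparable : ∀ t f k → PrefixComparable (segment (t ++ˢ f) k) t
segment-++ˢ-comparable []      f k       = inj₂ (segment f k , refl)
segment-++ˢ-comparable (x ∷ t) f zero    = inj₁ (x ∷ t , refl)
segment-++ˢ-comparable (x ∷ t) f (suc k) with segment-++ˢ-comparable t f k
... | inj₁ (m , e) = inj₁ (m , cong (x ∷_) e)
... | inj₂ (m , e) = inj₂ (m , cong (x ∷_) e)

++-prefix-⊆ₗ : ∀ r u m → (r ++ u) ⊆ₗ (r ++ (u ++ m))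
++-prefix-⊆ₗ r u m x x∈ = subst (x ∈_) (++-assoc r u m) (∈-++⁺ˡ x∈)

module SubBarrier (em : ExcludedMiddle) (B : Family) (bar : IsBarrier B) {I : Set} (g : List ℕ → I)
                  (β : List ℕ → List I) (g∈β : ∀ a b → B a → B b → a ◁ b → g (a ∪ b) ∈ β a) where

  open IsBarrier bar

  PrefixComparable⇒≡ : ∀ r u t → B (r ++ u) → B (r ++ t) → PrefixComparable u t → r ++ u ≡ r ++ t
  PrefixComparable⇒≡ r u t Bu Bt (inj₁ (m , refl)) = antichain (r ++ u) (r ++ (u ++ m)) Bu Bt (++-prefix-⊆ₗ r u m)
  PrefixComparable⇒≡ r u t Bu Bt (inj₂ (m , refl)) = sym (antichain (r ++ t) (r ++ (t ++ m)) Bt Bu (++-prefix-⊆ₗ r t m))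

  ◁-split : ∀ {a b} → StrictlyIncreasing b → a ◁ b →
            ∃[ k ] (drop 1 a ++ drop k b ≡ b × All (λ z → All (_< z) a) (drop k b))
  ◁-split lb (x , _ , y , s′ , refl , refl , x<y , k , _ , refl) =
    k , take++drop≡id k (y ∷ s′) , All.zipWith (λ (y≤z , take<z) → <-≤-trans x<y y≤z ∷ take<z) (y≤drop , take<drop)
    where
    y≤drop : All (y ≤_) (drop k (y ∷ s′))
    y≤drop = drop⁺ k (≤-refl ∷ All.map <⇒≤ (Linked-head< lb))
    take<drop : All (λ z → All (_< z) (take k (y ∷ s′))) (drop k (y ∷ s′))
    take<drop = Linked-++⇒< (take k (y ∷ s′)) _ (subst StrictlyIncreasing (sym (take++drop≡id k (y ∷ s′))) lb)

  ◁⇒⊆∪above : ∀ a b → StrictlyIncreasing b → a ◁ b → All (λ z → z ∈ a ⊎ All (_< z) a) b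
  ◁⇒⊆∪above a b lb a◁b with ◁-split lb a◁b
  ... | k , split , a<tail = subst (All _) split (++⁺ (All.map inj₁ (drop1-⊆ a)) (All.map inj₂ a<tail))
    where
    drop1-⊆ : ∀ a → All (_∈ a) (drop 1 a)
    drop1-⊆ []      = []
    drop1-⊆ (x ∷ r) = All.tabulate there

  Within : List ℕ → InfSet → List ℕ → Set
  Within a X = All (λ z → z ∈ a ⊎ (All (_< z) a × z ∈ᵢ X))

  tail-⊆ᵢ : ∀ {a b} N k → Within a N b → All (λ z → All (_< z) a) (drop k b) → All (_∈ᵢ N) (drop k b)
  tail-⊆ᵢ {a} N k within a<tail = All.zipWith tail∈N (drop⁺ k within , a<tail)
    where
    tail∈N : ∀ {z} → (z ∈ a ⊎ (All (_< z) a × z ∈ᵢ N)) × All (_< z) a → z ∈ᵢ N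
    tail∈N (inj₁ z∈a , a<z)      = ⊥-elim (<-irrefl refl (All.lookup a<z z∈a))
    tail∈N (inj₂ (_ , z∈N) , _) = z∈N

  ColourDetermined : Pred₂
  ColourDetermined a X = B a → ∀ b b′ → B b → B b′ → a ◁ b → a ◁ b′ →
                         Within a X b → Within a X b′ → g (a ∪ b) ≡ g (a ∪ b′)

  ColourDetermined-hereditary : HereditaryAbove ColourDetermined
  ColourDetermined-hereditary a X Y X⊆Y det Ba b b′ Bb Bb′ a◁b a◁b′ wb wb′ =
    det Ba b b′ Bb Bb′ a◁b a◁b′ (widen wb) (widen wb′)
    where
    widen : ∀ {b} → Within a X b → Within a Y b
    widen = All.map λ { (inj₁ z∈a) → inj₁ z∈a
                      ; (inj₂ (a<z , (k , refl))) → inj₂ (a<z , X⊆Y k a<z) }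

  Tails : List ℕ → I → List ℕ → Set
  Tails a y t = B (drop 1 a ++ t) × g (a ∪ (drop 1 a ++ t)) ≡ y

  module NW (a : List ℕ) (y : I) = NashWilliams em (Tails a y)

  Decided : List ℕ → I → InfSet → Set
  Decided a y N = NW.Avoids a y N ⊎ NW.Accepts a y N []

  Decided-⊆ᵢ : ∀ a y {N N′} → N′ ⊆ᵢ N → Decided a y N → Decided a y N′
  Decided-⊆ᵢ a y N′⊆N (inj₁ avoids) = inj₁ λ t l t⊆N′ → avoids t l (All-∈ᵢ-⊆ᵢ t⊆N′ N′⊆N)
  Decided-⊆ᵢ a y N′⊆N (inj₂ accepts) = inj₂ λ X X⊆N′ → accepts X (⊆ᵢ-trans X⊆N′ N′⊆N)

  decideAll : ∀ a (L : List I) M → ∃[ N ] (N ⊆ᵢ M × All (λ y → Decided a y N) L)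
  decideAll a []      M = M , ⊆ᵢ-refl , []
  decideAll a (y ∷ L) M with NW.nashWilliams a y M
  ... | N₁ , N₁⊆M , decided with decideAll a L N₁
  ... | N₂ , N₂⊆N₁ , decidedL = N₂ , ⊆ᵢ-trans N₂⊆N₁ N₁⊆M , Decided-⊆ᵢ a y N₂⊆N₁ decided ∷ decidedL

  avoided-colour-absent : ∀ a y N → NW.Avoids a y N → ∀ b → B b → a ◁ b → Within a N b → g (a ∪ b) ≢ y
  avoided-colour-absent a y N avoids b Bb a◁b within g≡y with ◁-split (finiteSets b Bb) a◁b
  ... | k , split , a<tail =
    avoids (drop k b) (Linked-drop k (finiteSets b Bb)) (tail-⊆ᵢ N k within a<tail)
           (subst B (sym split) Bb , trans (cong (λ v → g (a ∪ v)) split) g≡y)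

  -- The tail t of b, continued by elements of N, has an initial segment in Tails a y; the antichain property forces it to be t.
  accepted-colour-forced : ∀ a y N → NW.Accepts a y N [] → ∀ b → B b → a ◁ b → Within a N b → g (a ∪ b) ≡ y
  accepted-colour-forced a y N accepts b Bb a◁b within with ◁-split (finiteSets b Bb) a◁b
  ... | k , split , a<tail = forced (accepts X X⊆N (λ _ → []))
    where
    t = drop k b
    f = enum (dropᵢ (bound t) N)
    X : InfSet
    X = mkInfSet (t ++ˢ f) (++ˢ-increasing t f (Linked-drop k (finiteSets b Bb)) (Above-dropᵢ-bound t N 0)
                                              (increasing (dropᵢ (bound t) N)))
    X⊆N : X ⊆ᵢ N
    X⊆N = mk⊆ᵢ (++ˢ-∈ᵢ {N} t f (tail-⊆ᵢ N k within a<tail) (enum-∈ᵢ (dropᵢ-⊆ᵢ (bound t) N)))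
    forced : ∃[ k₀ ] Tails a y (segment (enum X) k₀) → g (a ∪ b) ≡ y
    forced (k₀ , Bu , gu≡y) = trans (cong (λ v → g (a ∪ v)) (trans (sym split) (sym u≡t))) gu≡y
      where
      u≡t : drop 1 a ++ segment (enum X) k₀ ≡ drop 1 a ++ t
      u≡t = PrefixComparable⇒≡ (drop 1 a) _ _ Bu (subst B (sym split) Bb) (segment-++ˢ-comparable t f k₀)

  ColourDetermined-dense : Dense ColourDetermined
  ColourDetermined-dense a M with decideAll a (β a) M
  ... | N , N⊆M , decided = N , N⊆M , determined
    where
    determined : ColourDetermined a N
    determined Ba b b′ Bb Bb′ a◁b a◁b′ wb wb′ with All.lookup decided (g∈β a b′ Ba Bb′ a◁b′)
    ... | inj₁ avoids  = ⊥-elim (avoided-colour-absent a _ N avoids b′ Bb′ a◁b′ wb′ refl)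
    ... | inj₂ accepts = accepted-colour-forced a _ N accepts b Bb a◁b wb

  private
    fused = fusion ColourDetermined-hereditary ColourDetermined-dense (baseInfSet em finiteSets infinite)

  N : InfSet
  N = proj₁ fused

  N⊆Base : ∀ {z} → z ∈ᵢ N → Base B z
  N⊆Base z∈N = baseInfSet-⊆Base em finiteSets infinite (∈ᵢ-⊆ᵢ z∈N (proj₁ (proj₂ fused)))

  N-determined : Everywhere ColourDetermined N
  N-determined = proj₂ (proj₂ fused)

  C : Family
  C s = B s × All (_∈ᵢ N) s

  -- An initial segment in B of N above all members of L would be a member of C outside L.
  C-infinite : InfiniteFamily C
  C-infinite (L , C⊆L) = no-initial (initial (enum X) (increasing X) (λ k → N⊆Base (k + b₀ , refl)))
    where
    b₀ = bound (map sum L)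
    X = dropᵢ b₀ N
    no-initial : ∃[ k ] B (initSeg (enum X) k) → ⊥
    no-initial (zero , B[]) = infinite ([] ∷ [] , λ t Bt → here (sym (antichain [] t B[] Bt λ _ ())))
    no-initial (suc k , Bs) =
      <⇒≱ (increasing-inflationary (increasing N) b₀) (≤-trans x₀≤sum (∈⇒≤sum (∈-map⁺ sum s∈L)))
      where
      s = initSeg (enum X) (suc k)
      x₀≤sum : enum X 0 ≤ sum s
      x₀≤sum = ∈⇒≤sum {s = s} (here refl)
      s∈L : s ∈ L
      s∈L = C⊆L s (Bs , All-initSeg (enum X) (λ j → j + b₀ , refl) (suc k))

  C-barrier : IsBarrier C
  C-barrier = record
    { finiteSets = λ s → finiteSets s ∘ proj₁
    ; infinite   = C-infinite
    ; antichain  = λ s t Cs Ct → antichain s t (proj₁ Cs) (proj₁ Ct)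
    ; initial    = C-initial
    }
    where
    Base-C⇒Base-B : ∀ {z} → Base C z → Base B z
    Base-C⇒Base-B (s , (Bs , _) , z∈s) = s , Bs , z∈s
    Base-C⇒∈ᵢN : ∀ {z} → Base C z → z ∈ᵢ N
    Base-C⇒∈ᵢN (s , (_ , s⊆N) , z∈s) = All.lookup s⊆N z∈s
    C-initial : ∀ f → StrictlyIncreasingSeq f → (∀ n → Base C (f n)) → ∃[ k ] C (initSeg f k)
    C-initial f f-inc f⊆Base with initial f f-inc (Base-C⇒Base-B ∘ f⊆Base)
    ... | k , Bs = k , Bs , All-initSeg f (Base-C⇒∈ᵢN ∘ f⊆Base) k

  C-within : ∀ a b → C b → a ◁ b → Within a N b
  C-within a b (Bb , b⊆N) a◁b = All.zipWith within (◁⇒⊆∪above a b (finiteSets b Bb) a◁b , b⊆N)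
    where
    within : ∀ {z} → (z ∈ a ⊎ All (_< z) a) × z ∈ᵢ N → z ∈ a ⊎ (All (_< z) a × z ∈ᵢ N)
    within (inj₁ z∈a , _)   = inj₁ z∈a
    within (inj₂ a<z , z∈N) = inj₂ (a<z , z∈N)

  -- g [] is an arbitrary value, for the a that have no ◁-successor in C.
  colour : List ℕ → I
  colour a with em (∃[ b ] (C b × a ◁ b))
  ... | yes (b , _) = g (a ∪ b)
  ... | no _        = g []

  colour-correct : ∀ a b → C a → C b → a ◁ b → g (a ∪ b) ≡ colour a
  colour-correct a b (Ba , a⊆N) Cb a◁b with em (∃[ b ] (C b × a ◁ b))
  ... | yes (b′ , Cb′ , a◁b′) = N-determined a (finiteSets a Ba) a⊆N Ba b b′ (proj₁ Cb) (proj₁ Cb′) a◁b a◁b′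
                                  (C-within a b Cb a◁b) (C-within a b′ Cb′ a◁b′)
  ... | no ¬succ = ⊥-elim (¬succ (b , Cb , a◁b))

mainTheorem17 : ExcludedMiddle →
    (B : Family) → IsBarrier B →
    (I : Set) → (g : List ℕ → I) →
    (Σ (List ℕ → List I) λ β → (∀ a b → B a → B b → a ◁ b → g (a ∪ b) ∈ β a)) →
    Σ Family λ C → (IsBarrier C × (∀ s → C s → B s)
      × Σ (List ℕ → I) λ i → (∀ a b → C a → C b → a ◁ b → g (a ∪ b) ≡ i a))
mainTheorem17 em B bar I g (β , g∈β) = C , C-barrier , (λ _ → proj₁) , colour , colour-correct
  where open SubBarrier em B bar g β g∈β
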